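{- Let $h\ge 2$ and let $T_h$ be the complete binary tree of height $h$. Every layout of $T_h$ of \textsc{MinWLA} type attains the minimum value of the weighted mean edge length $\bar\ell_1$ over all Recursive Layouts of $T_h$ with cut height $g=1$.
   Context: The complete binary tree $T_h$ of height $h$ has levels $0,\dots,h-1$ (the root is on level $0$, level $d$ has $2^d$ nodes), hence $2^h-1$ nodes. A layout is a bijection $\pi$ from the nodes to $\{1,\dots,2^h-1\}$. For an edge $e=uv$ its length is $\ell_e=|\pi(u)-\pi(v)|$. If $e$ joins a node on level $d-1$ to a node on level $d$, its weight is $w_e=2^{ -d}$. Let $W=\sum_e w_e$. The weighted mean edge length is $\bar\ell_1=\frac1W\sum_e w_e\ell_e$. For a node $v$, let $T_v$ denote the subtree consisting of $v$ and all its descendants. A Recursive Layout with cut height $1$ is a layout $\pi$ satisfying the following conditions. First, for every node $v$ the set $\pi(T_v)$ is a contiguous interval of integers. Second, every node $v$ with children, i.e. every $v$ for which $T_v$ has height at least $2$, has one of two types: - in-order type: $\pi(v)$ lies strictly between the intervals occupied by its two child subtrees; - pre-order type: $\pi(v)$ is an endpoint of the interval $\pi(T_v)$, so both child subtrees lie on the same side of $\pi(v)$. This type covers both pre-order and post-order placement. Either child subtree may be placed on either side. The layout is further constrained as follows: (i) if $v$ is not the root and has pre-order type, then $\pi(v)$ is the endpoint of $\pi(T_v)$ nearer to $\pi(\mathrm{parent}(v))$; (ii) if $v$ has pre-order type, both of its children have children, and the child subtree whose interval is adjacent to $\pi(v)$ has a root of in-order type, then the root of the other child subtree also has in-order type.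 A \textsc{MinWLA}-type layout is a Recursive Layout with cut height $1$ in which the root has in-order type and every other node with children has pre-order type. -}

module Defs where

open import Data.Nat as ℕ using (ℕ; zero; suc; _∸_; _^_; ∣_-_∣)
open import Data.Fin using (Fin; toℕ)
open import Data.Integer using (+_)
open import Data.Rational as ℚ using (ℚ; 0ℚ; 1ℚ; ½; _÷_)
open import Data.Rational.Properties using () renaming (_≟_ to _≟ℚ_)
open import Data.List using (List; []; _∷_; _++_; map; foldr)
open import Data.Product using (_×_; _,_; ∃; ∃-syntax; Σ-syntax)
open import Data.Sum using (_⊎_)
open import Data.Empty using (⊥)
open import Relation.Nullary using (¬_; yes; no)
open import Relation.Binary.PropositionalEquality using (_≡_; _≢_)
open import Function.Bundles using (_⤖_; Bijection)

-- Nodes of the complete binary tree T_h of height h (levels 0..h-1):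
-- a node of T_(h+1) is the root, or a node of the left copy of T_h,
-- or a node of the right copy of T_h.  Node 0 is empty.

data Node : ℕ → Set where
  root  : ∀ {h} → Node (suc h)
  left  : ∀ {h} → Node h → Node (suc h)
  right : ∀ {h} → Node h → Node (suc h)

depth : ∀ {h} → Node h → ℕ
depth root      = 0
depth (left v)  = suc (depth v)
depth (right v) = suc (depth v)

data _≼_ : ∀ {h} → Node h → Node h → Set where
  root≼  : ∀ {h} {u : Node (suc h)} → root ≼ u
  left≼  : ∀ {h} {v u : Node h} → v ≼ u → left v ≼ left u
  right≼ : ∀ {h} {v u : Node h} → v ≼ u → right v ≼ right u

data Child : ∀ {h} → Node h → Node h → Set where
  lc : ∀ {k} → Child {suc (suc k)} (left root) root
  rc : ∀ {k} → Child {suc (suc k)} (right root) root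
  cl : ∀ {h} {c v : Node h} → Child c v → Child (left c) (left v)
  cr : ∀ {h} {c v : Node h} → Child c v → Child (right c) (right v)

HasChildren : ∀ {h} → Node h → Set
HasChildren v = ∃[ c ] Child c v

IsRoot : ∀ {h} → Node h → Set
IsRoot v = ¬ (∃[ p ] Child v p)

rootEdges : ∀ h → List (Node (suc h) × Node (suc h))
rootEdges zero    = []
rootEdges (suc k) = (root , left root) ∷ (root , right root) ∷ []

edges : ∀ h → List (Node h × Node h)
edges zero    = []
edges (suc h) = rootEdges h
             ++ (map (λ { (p , c) → (left p , left c) }) (edges h)
             ++ map (λ { (p , c) → (right p , right c) }) (edges h))

-- Layouts: bijections from the nodes of T_h to {1,…,2^h-1}.
-- We use Fin (2^h ∸ 1) = {0,…,2^h-2}; position of v is toℕ (π v) + 1,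
-- a uniform shift which does not affect any length or order.

Layout : ℕ → Set
Layout h = Node h ⤖ Fin (2 ^ h ∸ 1)

module _ {h : ℕ} (π : Layout h) where

  pos : Node h → ℕ
  pos v = suc (toℕ (Bijection.to π v))

  len : Node h × Node h → ℕ
  len (u , v) = ∣ pos u - pos v ∣

  Contiguous : Set
  Contiguous = ∀ (v a b : Node h) (k : ℕ) → v ≼ a → v ≼ b →
               pos a ℕ.≤ k → k ℕ.≤ pos b → ∃[ u ] (v ≼ u × pos u ≡ k)

  InOrder : Node h → Set
  InOrder v = ∃[ c₁ ] ∃[ c₂ ] (Child c₁ v × Child c₂ v × c₁ ≢ c₂ ×
                (∀ u → c₁ ≼ u → pos u ℕ.< pos v) ×
                (∀ u → c₂ ≼ u → pos v ℕ.< pos u))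

  MinEnd : Node h → Set
  MinEnd v = ∀ u → v ≼ u → pos v ℕ.≤ pos u

  MaxEnd : Node h → Set
  MaxEnd v = ∀ u → v ≼ u → pos u ℕ.≤ pos v

  -- pre-order type (covers pre- and post-order)
  PreOrder : Node h → Set
  PreOrder v = MinEnd v ⊎ MaxEnd v

  CondI : Set
  CondI = ∀ v p → Child v p → HasChildren v → PreOrder v →
          (pos p ℕ.< pos v → MinEnd v) × (pos v ℕ.< pos p → MaxEnd v)

  AdjacentTo : Node h → Node h → Set
  AdjacentTo c v = ∃[ u ] (c ≼ u × ∣ pos u - pos v ∣ ≡ 1)

  CondII : Set
  CondII = ∀ v c₁ c₂ → PreOrder v → Child c₁ v → Child c₂ v → c₁ ≢ c₂ →
           HasChildren c₁ → HasChildren c₂ → AdjacentTo c₁ v →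
           InOrder c₁ → InOrder c₂

  -- Recursive Layout with cut height 1
  RecursiveLayout : Set
  RecursiveLayout = Contiguous ×
                    (∀ v → HasChildren v → InOrder v ⊎ PreOrder v) ×
                    CondI × CondII

  MinWLAType : Set
  MinWLAType = RecursiveLayout ×
               (∀ v → HasChildren v → IsRoot v → InOrder v) ×
               (∀ v → HasChildren v → ¬ IsRoot v → PreOrder v)

halfPow : ℕ → ℚ
halfPow zero    = 1ℚ
halfPow (suc d) = ½ ℚ.* halfPow d

weight : ∀ {h} → Node h × Node h → ℚ
weight (p , c) = halfPow (depth c)

ℕtoℚ : ℕ → ℚ
ℕtoℚ n = + n ℚ./ 1

totalWeight : ℕ → ℚ
totalWeight h = foldr (λ e s → weight e ℚ.+ s) 0ℚ (edges h)

weightedLength : ∀ {h} → Layout h → ℚ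
weightedLength {h} π =
  foldr (λ e s → weight e ℚ.* ℕtoℚ (len π e) ℚ.+ s) 0ℚ (edges h)

-- division, total (returns 0 when dividing by 0; W > 0 whenever h ≥ 2)
_div_ : ℚ → ℚ → ℚ
p div q with q ≟ℚ 0ℚ
... | yes _  = 0ℚ
... | no q≢0 = _÷_ p q {{ℚ.≢-nonZero q≢0}}

meanLength : ∀ {h} → Layout h → ℚ
meanLength {h} π = weightedLength π div totalWeight h

-- Multiplying the weighted length by 2^(h-1) gives an integer cost, computed recursively from the
-- two root edges and the costs of the two subtrees.  In a MinWLA-type layout both root edges have
-- length 1, and a pre-order node w has one child next to it and the other just beyond that child's
-- subtree, so its two edges have total length at most 2 + b(w), where b(w) = 2^(height w - 1) - 1
-- (branchSize w) is the size of a child subtree.  In any recursive layout the two edges below v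
-- have total length at least 2, plus b(v) if v has pre-order type, plus b(c) for each child c of
-- in-order type (half of T_c lies between v and c).  The excess b(c) of an in-order c thus sits on
-- the edge above c, whose weight is twice that of the edges below c, so in-order type costs c at
-- least as much as pre-order type; only the root, having no edge above it, gains from in-order
-- type.
module Submission where

open import Defs
open import Data.Nat as ℕ using (ℕ; zero; suc; _+_; _*_; _∸_; _^_; _≤_; _<_; z≤n; s≤s; ∣_-_∣)
open import Data.Nat.Properties
open import Data.Nat.Tactic.RingSolver using (solve-∀)
import Data.Nat.Coprimality as Coprime
open import Data.Fin using (toℕ; opposite)
import Data.Fin.Properties as Fin
open import Data.Integer as ℤ using (+_; +≤+)
import Data.Integer.Properties as ℤ
open import Data.Rational as ℚ using (ℚ; mkℚ; 0ℚ; 1ℚ; ½; NonNegative) renaming (_≤_ to _≤ℚ_)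
import Data.Rational.Properties as ℚ
import Data.Rational.Unnormalised as ℚᵘ
import Data.Rational.Unnormalised.Properties as ℚᵘ
open import Data.Rational.Solver using (module +-*-Solver)
open import Data.List using (List; []; _∷_; _++_; map; length; foldr)
open import Data.List.Properties using (length-map; length-++; foldr-map)
open import Data.List.Membership.Propositional using (_∈_)
open import Data.List.Membership.Propositional.Properties
  using (∈-map⁺; ∈-map⁻; ∈-++⁺ˡ; ∈-++⁺ʳ; ∈-++⁻; ∈-∃++)
import Data.List.Relation.Unary.All as All
import Data.List.Relation.Unary.All.Properties as All
open import Data.List.Relation.Unary.AllPairs using (_∷_; [])
open import Data.List.Relation.Unary.Any using (here; there)
open import Data.List.Relation.Unary.Unique.Propositional using (Unique)
import Data.List.Relation.Unary.Unique.Propositional.Properties as Unique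
open import Data.Product as × using (_×_; _,_; ∃-syntax; proj₁; proj₂)
open import Data.Sum using (_⊎_; inj₁; inj₂)
open import Data.Empty using (⊥-elim)
open import Function using (_∘_)
open import Function.Bundles using (Bijection; mk↔ₛ′)
open import Function.Properties.Inverse using (↔⇒⤖)
open import Function.Construct.Composition using (_⤖-∘_)
open import Relation.Nullary using (¬_; yes; no)
open import Relation.Binary.Definitions using (Tri; tri<; tri≈; tri>)
open import Relation.Binary.PropositionalEquality

left-injective : ∀ {h} {u v : Node h} → left u ≡ left v → u ≡ v
left-injective refl = refl

right-injective : ∀ {h} {u v : Node h} → right u ≡ right v → u ≡ v
right-injective refl = refl

≼-refl : ∀ {h} (v : Node h) → v ≼ v
≼-refl root      = root≼
≼-refl (left v)  = left≼ (≼-refl v)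
≼-refl (right v) = right≼ (≼-refl v)

≼-trans : ∀ {h} {a b c : Node h} → a ≼ b → b ≼ c → a ≼ c
≼-trans root≼      _          = root≼
≼-trans (left≼ p)  (left≼ q)  = left≼ (≼-trans p q)
≼-trans (right≼ p) (right≼ q) = right≼ (≼-trans p q)

≼-depth : ∀ {h} {a b : Node h} → a ≼ b → depth a ≤ depth b
≼-depth root≼      = z≤n
≼-depth (left≼ p)  = s≤s (≼-depth p)
≼-depth (right≼ p) = s≤s (≼-depth p)

ancestors-comparable : ∀ {h} {a b u : Node h} → a ≼ u → b ≼ u → a ≼ b ⊎ b ≼ a
ancestors-comparable root≼      _          = inj₁ root≼
ancestors-comparable (left≼ _)  root≼      = inj₂ root≼
ancestors-comparable (right≼ _) root≼      = inj₂ root≼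
ancestors-comparable (left≼ p)  (left≼ q)  with ancestors-comparable p q
... | inj₁ a≼b = inj₁ (left≼ a≼b)
... | inj₂ b≼a = inj₂ (left≼ b≼a)
ancestors-comparable (right≼ p) (right≼ q) with ancestors-comparable p q
... | inj₁ a≼b = inj₁ (right≼ a≼b)
... | inj₂ b≼a = inj₂ (right≼ b≼a)

parent≼child : ∀ {h} {c v : Node h} → Child c v → v ≼ c
parent≼child lc     = root≼
parent≼child rc     = root≼
parent≼child (cl x) = left≼ (parent≼child x)
parent≼child (cr x) = right≼ (parent≼child x)

depth-child : ∀ {h} {c v : Node h} → Child c v → depth c ≡ suc (depth v)
depth-child lc     = refl
depth-child rc     = refl
depth-child (cl x) = cong suc (depth-child x)
depth-child (cr x) = cong suc (depth-child x)

child⋠parent : ∀ {h} {c v : Node h} → Child c v → ¬ (c ≼ v)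
child⋠parent ch c≼v = <⇒≱ (≤-reflexive (sym (depth-child ch))) (≼-depth c≼v)

siblings-incomparable : ∀ {h} {a b v : Node h} → Child a v → Child b v → a ≢ b → ¬ (a ≼ b)
siblings-incomparable lc     lc     a≢b _          = a≢b refl
siblings-incomparable rc     rc     a≢b _          = a≢b refl
siblings-incomparable (cl x) (cl y) a≢b (left≼ p)  = siblings-incomparable x y (a≢b ∘ cong left) p
siblings-incomparable (cr x) (cr y) a≢b (right≼ p) = siblings-incomparable x y (a≢b ∘ cong right) p

child-is-one-of : ∀ {h} {a b c v : Node h} → Child a v → Child b v → a ≢ b → Child c v → c ≡ a ⊎ c ≡ b
child-is-one-of lc     lc     a≢b _      = ⊥-elim (a≢b refl)
child-is-one-of rc     rc     a≢b _      = ⊥-elim (a≢b refl)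
child-is-one-of lc     rc     _   lc     = inj₁ refl
child-is-one-of lc     rc     _   rc     = inj₂ refl
child-is-one-of rc     lc     _   lc     = inj₂ refl
child-is-one-of rc     lc     _   rc     = inj₁ refl
child-is-one-of (cl x) (cl y) a≢b (cl z) with child-is-one-of x y (a≢b ∘ cong left) z
... | inj₁ c≡a = inj₁ (cong left c≡a)
... | inj₂ c≡b = inj₂ (cong left c≡b)
child-is-one-of (cr x) (cr y) a≢b (cr z) with child-is-one-of x y (a≢b ∘ cong right) z
... | inj₁ c≡a = inj₁ (cong right c≡a)
... | inj₂ c≡b = inj₂ (cong right c≡b)

descendant-via-child : ∀ {h} {v u : Node h} → v ≼ u → u ≢ v → ∃[ c ] (Child c v × c ≼ u)
descendant-via-child {u = root} root≼ u≢v = ⊥-elim (u≢v refl)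
descendant-via-child {suc (suc h)} {u = left u}  root≼ _ = left root , lc , left≼ root≼
descendant-via-child {suc (suc h)} {u = right u} root≼ _ = right root , rc , right≼ root≼
descendant-via-child (left≼ p) u≢v with descendant-via-child p (u≢v ∘ cong left)
... | c , ch , c≼u = left c , cl ch , left≼ c≼u
descendant-via-child (right≼ p) u≢v with descendant-via-child p (u≢v ∘ cong right)
... | c , ch , c≼u = right c , cr ch , right≼ c≼u

Leaf : ∀ {h} → Node h → Set
Leaf v = ∀ u → v ≼ u → u ≡ v

hasChildren? : ∀ {h} (v : Node h) → HasChildren v ⊎ Leaf v
hasChildren? {suc zero}    root = inj₂ λ { root root≼ → refl }
hasChildren? {suc (suc h)} root = inj₁ (left root , lc)
hasChildren? (left v) with hasChildren? v
... | inj₁ (c , ch) = inj₁ (left c , cl ch)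
... | inj₂ leaf     = inj₂ λ { (left u) (left≼ p) → cong left (leaf u p) }
hasChildren? (right v) with hasChildren? v
... | inj₁ (c , ch) = inj₁ (right c , cr ch)
... | inj₂ leaf     = inj₂ λ { (right u) (right≼ p) → cong right (leaf u p) }

leaf-childless : ∀ {h} {c v : Node h} → Leaf v → ¬ Child c v
leaf-childless leaf ch = child⋠parent ch (subst (_≼ _) (sym (leaf _ (parent≼child ch))) (≼-refl _))

left-right-parents : ∀ {h} (v : Node (suc h)) → (∃[ p ] Child (left v) p) × (∃[ p ] Child (right v) p)
left-right-parents root = (root , lc) , (root , rc)
left-right-parents {suc h} (left v)  with (p , ch) , _ ← left-right-parents v =
  (left p , cl ch) , (right p , cr ch)
left-right-parents {suc h} (right v) with _ , (p , ch) ← left-right-parents v =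
  (left p , cl ch) , (right p , cr ch)

left-not-root : ∀ {h} (v : Node (suc h)) → ¬ IsRoot (left v)
left-not-root v isRoot = isRoot (proj₁ (left-right-parents v))

right-not-root : ∀ {h} (v : Node (suc h)) → ¬ IsRoot (right v)
right-not-root v isRoot = isRoot (proj₂ (left-right-parents v))

root-isRoot : ∀ {h} → IsRoot {suc h} root
root-isRoot (_ , ())

height : ∀ {h} → Node h → ℕ
height {h} v = h ∸ depth v

height-child : ∀ {h} {c v : Node h} → Child c v → height c ≡ height v ∸ 1
height-child {h} {c} {v} ch = begin
  h ∸ depth c       ≡⟨ cong (h ∸_) (trans (depth-child ch) (+-comm 1 (depth v))) ⟩
  h ∸ (depth v + 1) ≡⟨ sym (∸-+-assoc h (depth v) 1) ⟩
  h ∸ depth v ∸ 1   ∎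
  where open ≡-Reasoning

nodes : ∀ h → List (Node h)
nodes zero    = []
nodes (suc h) = root ∷ (map left (nodes h) ++ map right (nodes h))

subtree : ∀ {h} → Node h → List (Node h)
subtree {suc h} root = nodes (suc h)
subtree (left v)     = map left (subtree v)
subtree (right v)    = map right (subtree v)

∈-nodes : ∀ h (u : Node h) → u ∈ nodes h
∈-nodes (suc h) root      = here refl
∈-nodes (suc h) (left u)  = there (∈-++⁺ˡ (∈-map⁺ left (∈-nodes h u)))
∈-nodes (suc h) (right u) = there (∈-++⁺ʳ (map left (nodes h)) (∈-map⁺ right (∈-nodes h u)))

∈-subtree⁺ : ∀ {h} {v u : Node h} → v ≼ u → u ∈ subtree v
∈-subtree⁺ {u = u} root≼ = ∈-nodes _ u
∈-subtree⁺ (left≼ p)     = ∈-map⁺ left (∈-subtree⁺ p)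
∈-subtree⁺ (right≼ p)    = ∈-map⁺ right (∈-subtree⁺ p)

∈-subtree⁻ : ∀ {h} {v u : Node h} → u ∈ subtree v → v ≼ u
∈-subtree⁻ {suc h} {root} _ = root≼
∈-subtree⁻ {v = left v} u∈ with _ , x∈ , refl ← ∈-map⁻ left u∈ = left≼ (∈-subtree⁻ x∈)
∈-subtree⁻ {v = right v} u∈ with _ , x∈ , refl ← ∈-map⁻ right u∈ = right≼ (∈-subtree⁻ x∈)

nodes-unique : ∀ h → Unique (nodes h)
nodes-unique zero    = []
nodes-unique (suc h) =
  All.++⁺ (All.map⁺ {f = left} (All.universal (λ _ ()) (nodes h)))
           (All.map⁺ {f = right} (All.universal (λ _ ()) (nodes h))) ∷
  Unique.++⁺ (Unique.map⁺ left-injective (nodes-unique h)) (Unique.map⁺ right-injective (nodes-unique h)) disjoint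
  where
  disjoint : ∀ {u} → ¬ (u ∈ map left (nodes h) × u ∈ map right (nodes h))
  disjoint (l∈ , r∈) with ∈-map⁻ left l∈ | ∈-map⁻ right r∈
  ... | _ , _ , refl | _ , _ , ()

subtree-unique : ∀ {h} (v : Node h) → Unique (subtree v)
subtree-unique {suc h} root = nodes-unique (suc h)
subtree-unique (left v)     = Unique.map⁺ left-injective (subtree-unique v)
subtree-unique (right v)    = Unique.map⁺ right-injective (subtree-unique v)

length-nodes : ∀ h → suc (length (nodes h)) ≡ 2 ^ h
length-nodes zero    = refl
length-nodes (suc h) = begin
  suc (suc (length (map left (nodes h) ++ map right (nodes h))))
    ≡⟨ cong (suc ∘ suc) (length-++ (map left (nodes h))) ⟩
  suc (suc (length (map left (nodes h)) + length (map right (nodes h))))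
    ≡⟨ cong₂ (λ l r → suc (suc (l + r))) (length-map left (nodes h)) (length-map right (nodes h)) ⟩
  suc (suc (n + n))   ≡⟨ cong suc (sym (+-suc n n)) ⟩
  suc n + suc n       ≡⟨ cong₂ _+_ (length-nodes h) (trans (length-nodes h) (sym (+-identityʳ (2 ^ h)))) ⟩
  2 ^ h + (2 ^ h + 0) ∎
  where
  open ≡-Reasoning
  n = length (nodes h)

length-subtree : ∀ {h} (v : Node h) → suc (length (subtree v)) ≡ 2 ^ height v
length-subtree {suc h} root = length-nodes (suc h)
length-subtree (left v)     = trans (cong suc (length-map left (subtree v))) (length-subtree v)
length-subtree (right v)    = trans (cong suc (length-map right (subtree v))) (length-subtree v)

branchSize : ∀ {h} → Node h → ℕ
branchSize v = 2 ^ (height v ∸ 1) ∸ 1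

length-subtree-child : ∀ {h} {c v : Node h} → Child c v → length (subtree c) ≡ branchSize v
length-subtree-child {c = c} {v} ch = begin
  length (subtree c)             ≡⟨ cong ℕ.pred (length-subtree c) ⟩
  2 ^ height c ∸ 1               ≡⟨ cong (λ k → 2 ^ k ∸ 1) (height-child ch) ⟩
  2 ^ (height v ∸ 1) ∸ 1         ∎
  where open ≡-Reasoning

unique-⊆⇒length≤ : ∀ {A : Set} {xs ys : List A} → Unique xs → (∀ {x} → x ∈ xs → x ∈ ys) → length xs ≤ length ys
unique-⊆⇒length≤ {xs = []}     _ _ = z≤n
unique-⊆⇒length≤ {xs = x ∷ xs} (x∉xs ∷ unique) ⊆ys with us , vs , refl ← ∈-∃++ (⊆ys (here refl)) = begin
  suc (length xs)                ≤⟨ s≤s (unique-⊆⇒length≤ unique ⊆us++vs) ⟩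
  suc (length (us ++ vs))        ≡⟨ cong suc (length-++ us) ⟩
  suc (length us + length vs)    ≡⟨ sym (+-suc (length us) (length vs)) ⟩
  length us + length (x ∷ vs)    ≡⟨ sym (length-++ us) ⟩
  length (us ++ x ∷ vs)          ∎
  where
  open ≤-Reasoning
  ⊆us++vs : ∀ {y} → y ∈ xs → y ∈ us ++ vs
  ⊆us++vs y∈ with ∈-++⁻ us (⊆ys (there y∈))
  ... | inj₁ y∈us          = ∈-++⁺ˡ y∈us
  ... | inj₂ (here refl)   = ⊥-elim (All.lookup x∉xs y∈ refl)
  ... | inj₂ (there y∈vs)  = ∈-++⁺ʳ us y∈vs

interval : ℕ → ℕ → List ℕ
interval a zero    = []
interval a (suc n) = suc a ∷ interval (suc a) n

length-interval : ∀ a n → length (interval a n) ≡ n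
length-interval a zero    = refl
length-interval a (suc n) = cong suc (length-interval (suc a) n)

∈-interval⁻ : ∀ a n {x} → x ∈ interval a n → a < x × x ≤ a + n
∈-interval⁻ a (suc n) (here refl) = ≤-refl , m<m+n a (s≤s z≤n)
∈-interval⁻ a (suc n) (there x∈)  with a<x , x≤ ← ∈-interval⁻ (suc a) n x∈ =
  <-trans (n<1+n a) a<x , ≤-trans x≤ (≤-reflexive (sym (+-suc a n)))

∈-interval⁺ : ∀ a n {x} → a < x → x ≤ a + n → x ∈ interval a n
∈-interval⁺ a zero    a<x x≤a+0 = ⊥-elim (<⇒≱ a<x (subst (_ ≤_) (+-identityʳ a) x≤a+0))
∈-interval⁺ a (suc n) {x} a<x x≤ with suc a ℕ.≟ x
... | yes refl = here refl
... | no  a+1≢x = there (∈-interval⁺ (suc a) n (≤∧≢⇒< a<x a+1≢x) (≤-trans x≤ (≤-reflexive (+-suc a n))))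

interval-unique : ∀ a n → Unique (interval a n)
interval-unique a zero    = []
interval-unique a (suc n) =
  All.tabulate (λ x∈ → <⇒≢ (proj₁ (∈-interval⁻ (suc a) n x∈))) ∷ interval-unique (suc a) n

∣[k∸m]-[k∸n]∣≡∣m-n∣ : ∀ {k m n} → m ≤ k → n ≤ k → ∣ (k ∸ m) - (k ∸ n) ∣ ≡ ∣ m - n ∣
∣[k∸m]-[k∸n]∣≡∣m-n∣ {k} {m} {n} m≤k n≤k = begin
  ∣ k ∸ m - k ∸ n ∣                      ≡⟨ ∣m+n-m+o∣≡∣n-o∣ (m + n) (k ∸ m) (k ∸ n) ⟨
  ∣ m + n + (k ∸ m) - m + n + (k ∸ n) ∣  ≡⟨ cong₂ ∣_-_∣ (shift m n m≤k)
                                              (trans (cong (_+ (k ∸ n)) (+-comm m n)) (shift n m n≤k)) ⟩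
  ∣ k + n - k + m ∣                      ≡⟨ ∣m+n-m+o∣≡∣n-o∣ k n m ⟩
  ∣ n - m ∣                              ≡⟨ ∣-∣-comm n m ⟩
  ∣ m - n ∣                              ∎
  where
  open ≡-Reasoning
  shift : ∀ a b → a ≤ k → a + b + (k ∸ a) ≡ k + b
  shift a b a≤k = trans (rearrange a b (k ∸ a)) (cong (_+ b) (m+[n∸m]≡n a≤k))
    where
    rearrange : ∀ a b d → a + b + d ≡ a + d + b
    rearrange = solve-∀

∣m-n∣≤o : ∀ {m n o} → m ≤ n → n ≤ m + o → ∣ m - n ∣ ≤ o
∣m-n∣≤o {m} {n} m≤n n≤m+o = subst (_≤ _) (sym (m≤n⇒∣m-n∣≡n∸m m≤n)) (m≤n+o⇒m∸n≤o n m n≤m+o)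

module _ {a b : ℕ} (a<b : a < b) where

  private
    n : ℕ
    n = b ∸ suc a

    a+1+n≡b : a + suc n ≡ b
    a+1+n≡b = trans (+-suc a n) (m+[n∸m]≡n a<b)

    ∣a-b∣≡1+n : ∣ a - b ∣ ≡ suc n
    ∣a-b∣≡1+n = begin
      ∣ a - b ∣         ≡⟨ m≤n⇒∣m-n∣≡n∸m (<⇒≤ a<b) ⟩
      b ∸ a             ≡⟨ cong (_∸ a) (sym a+1+n≡b) ⟩
      a + suc n ∸ a     ≡⟨ m+n∸m≡n a (suc n) ⟩
      suc n             ∎
      where open ≡-Reasoning

    <b⇒≤a+n : ∀ {x} → x < b → x ≤ a + n
    <b⇒≤a+n x<b = ≤-pred (subst (_ <_) (trans (sym a+1+n≡b) (+-suc a n)) x<b)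

  distinct-between : ∀ {xs : List ℕ} → Unique xs → (∀ {x} → x ∈ xs → a < x × x < b) →
                     suc (length xs) ≤ ∣ a - b ∣
  distinct-between {xs} unique between = begin
    suc (length xs)             ≤⟨ s≤s (unique-⊆⇒length≤ unique xs⊆interval) ⟩
    suc (length (interval a n)) ≡⟨ cong suc (length-interval a n) ⟩
    suc n                       ≡⟨ sym ∣a-b∣≡1+n ⟩
    ∣ a - b ∣                   ∎
    where
    open ≤-Reasoning
    xs⊆interval : ∀ {x} → x ∈ xs → x ∈ interval a n
    xs⊆interval x∈ with a<x , x<b ← between x∈ = ∈-interval⁺ a n a<x (<b⇒≤a+n x<b)

  covered-between : ∀ {xs : List ℕ} → (∀ x → a < x → x < b → x ∈ xs) → ∣ a - b ∣ ≤ suc (length xs)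
  covered-between {xs} covered = begin
    ∣ a - b ∣                   ≡⟨ ∣a-b∣≡1+n ⟩
    suc n                       ≡⟨ cong suc (length-interval a n) ⟨
    suc (length (interval a n)) ≤⟨ s≤s (unique-⊆⇒length≤ (interval-unique a n) interval⊆xs) ⟩
    suc (length xs)             ∎
    where
    open ≤-Reasoning
    interval⊆xs : ∀ {x} → x ∈ interval a n → x ∈ xs
    interval⊆xs {x} x∈ with a<x , x≤a+n ← ∈-interval⁻ a n x∈ =
      covered x a<x (subst (x <_) a+1+n≡b (≤-trans (s≤s x≤a+n) (≤-reflexive (sym (+-suc a n)))))

module _ {h : ℕ} (π : Layout h) where

  pos-injective : ∀ {u v} → pos π u ≡ pos π v → u ≡ v
  pos-injective = Bijection.injective π ∘ Fin.toℕ-injective ∘ suc-injective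

  pos≤2^h : ∀ v → pos π v ≤ 2 ^ h
  pos≤2^h v = ≤-trans (Fin.toℕ<n (Bijection.to π v)) (m∸n≤m (2 ^ h) 1)

  nodes-between : ∀ {a b} {L : List (Node h)} → pos π a < pos π b → Unique L →
                  (∀ {u} → u ∈ L → pos π a < pos π u × pos π u < pos π b) →
                  suc (length L) ≤ len π (a , b)
  nodes-between {L = L} a<b unique between =
    subst (λ n → suc n ≤ _) (length-map (pos π) L)
      (distinct-between a<b (Unique.map⁺ pos-injective unique) positions-between)
    where
    positions-between : ∀ {x} → x ∈ map (pos π) L → _
    positions-between x∈ with _ , u∈ , refl ← ∈-map⁻ (pos π) x∈ = between u∈

  subtree-covers : ∀ {a b c} → pos π a < pos π b →
                   (∀ x → pos π a < x → x < pos π b → ∃[ u ] (c ≼ u × pos π u ≡ x)) →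
                   len π (a , b) ≤ suc (length (subtree c))
  subtree-covers {c = c} a<b covered =
    subst (λ n → _ ≤ suc n) (length-map (pos π) (subtree c))
      (covered-between a<b λ x a<x x<b → occupied (covered x a<x x<b))
    where
    occupied : ∀ {x} → ∃[ u ] (c ≼ u × pos π u ≡ x) → x ∈ map (pos π) (subtree c)
    occupied (u , c≼u , refl) = ∈-map⁺ (pos π) (∈-subtree⁺ c≼u)

  MinEnd-below-child : ∀ {v c u} → MinEnd π v → Child c v → c ≼ u → pos π v < pos π u
  MinEnd-below-child {v} {c} {u} minEnd ch c≼u =
    ≤∧≢⇒< (minEnd u (≼-trans (parent≼child ch) c≼u)) λ eq →
      child⋠parent ch (subst (c ≼_) (sym (pos-injective eq)) c≼u)

  MaxEnd-above-child : ∀ {v c u} → MaxEnd π v → Child c v → c ≼ u → pos π u < pos π v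
  MaxEnd-above-child {v} {c} {u} maxEnd ch c≼u =
    ≤∧≢⇒< (maxEnd u (≼-trans (parent≼child ch) c≼u)) λ eq →
      child⋠parent ch (subst (c ≼_) (pos-injective eq) c≼u)

  subtree-below : Contiguous π → ∀ {c w u} → ¬ (c ≼ w) → pos π c < pos π w → c ≼ u → pos π u < pos π w
  subtree-below contiguous {c} {w} {u} c⋠w c<w c≼u with <-cmp (pos π u) (pos π w)
  ... | tri< u<w _ _ = u<w
  ... | tri≈ _ u≡w _ = ⊥-elim (c⋠w (subst (c ≼_) (pos-injective u≡w) c≼u))
  ... | tri> _ _ w<u with contiguous c c u (pos π w) (≼-refl c) c≼u (<⇒≤ c<w) (<⇒≤ w<u)
  ...   | w′ , c≼w′ , w′≡w = ⊥-elim (c⋠w (subst (c ≼_) (pos-injective w′≡w) c≼w′))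

  -- Every node on either side of the interval of T_c is separated from c by at least y nodes of T_c.
  Offset : Node h → ℕ → Set
  Offset c y = y ≡ 0 ⊎ (InOrder π c × y ≡ branchSize c)

  offset-nodes : ∀ {c y} → Offset c y →
                 ∃[ E ] (Unique E × length E ≡ y × (∀ {u} → u ∈ E → c ≼ u × pos π u < pos π c))
  offset-nodes (inj₁ refl) = [] , [] , refl , λ ()
  offset-nodes (inj₂ ((d , _ , ch , _ , _ , below , _) , refl)) =
    subtree d , subtree-unique d , length-subtree-child ch ,
    λ u∈ → ≼-trans (parent≼child ch) (∈-subtree⁻ u∈) , below _ (∈-subtree⁻ u∈)

  offset-distance : ∀ {v c y} → Offset c y → (∀ u → c ≼ u → pos π v < pos π u) → suc y ≤ len π (v , c)
  offset-distance {v} {c} offset above with E , unique , refl , inner ← offset-nodes offset =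
    nodes-between (above c (≼-refl c)) unique λ u∈ → above _ (proj₁ (inner u∈)) , proj₂ (inner u∈)

-- The mirror image of a layout; it reduces every MaxEnd case to a MinEnd case.
reverse : ∀ {h} → Layout h → Layout h
reverse π = ↔⇒⤖ (mk↔ₛ′ opposite opposite Fin.opposite-involutive Fin.opposite-involutive) ⤖-∘ π

module _ {h : ℕ} (π : Layout h) where

  private
    π′ = reverse π

  pos-reverse : ∀ v → pos π′ v ≡ 2 ^ h ∸ pos π v
  pos-reverse v = begin
    suc (toℕ (opposite i))       ≡⟨ cong suc (Fin.opposite-prop i) ⟩
    suc (n ∸ suc (toℕ i))        ≡⟨ +-∸-assoc 1 (Fin.toℕ<n i) ⟨
    n ∸ toℕ i                    ≡⟨ ∸-+-assoc (2 ^ h) 1 (toℕ i) ⟩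
    2 ^ h ∸ suc (toℕ i)          ∎
    where
    open ≡-Reasoning
    n = 2 ^ h ∸ 1
    i = Bijection.to π v

  reverse-< : ∀ {u v} → pos π u < pos π v → pos π′ v < pos π′ u
  reverse-< {u} {v} u<v rewrite pos-reverse u | pos-reverse v = ∸-monoʳ-< u<v (pos≤2^h π v)

  reverse-≤ : ∀ {u v} → pos π u ≤ pos π v → pos π′ v ≤ pos π′ u
  reverse-≤ {u} {v} u≤v rewrite pos-reverse u | pos-reverse v = ∸-monoʳ-≤ (2 ^ h) u≤v

  len-reverse : ∀ u v → len π′ (u , v) ≡ len π (u , v)
  len-reverse u v = trans (cong₂ ∣_-_∣ (pos-reverse u) (pos-reverse v))
                          (∣[k∸m]-[k∸n]∣≡∣m-n∣ (pos≤2^h π u) (pos≤2^h π v))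

  reverse-InOrder : ∀ {v} → InOrder π v → InOrder π′ v
  reverse-InOrder (c₁ , c₂ , ch₁ , ch₂ , c₁≢c₂ , below , above) =
    c₂ , c₁ , ch₂ , ch₁ , c₁≢c₂ ∘ sym ,
    (λ u c₂≼u → reverse-< (above u c₂≼u)) , (λ u c₁≼u → reverse-< (below u c₁≼u))

  reverse-MinEnd : ∀ {v} → MinEnd π v → MaxEnd π′ v
  reverse-MinEnd minEnd u v≼u = reverse-≤ (minEnd u v≼u)

  reverse-MaxEnd : ∀ {v} → MaxEnd π v → MinEnd π′ v
  reverse-MaxEnd maxEnd u v≼u = reverse-≤ (maxEnd u v≼u)

  reverse-Offset : ∀ {c y} → Offset π c y → Offset π′ c y
  reverse-Offset (inj₁ y≡0)             = inj₁ y≡0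
  reverse-Offset (inj₂ (inOrder , y≡b)) = inj₂ (reverse-InOrder inOrder , y≡b)

  reverse-Contiguous : Contiguous π → Contiguous π′
  reverse-Contiguous contiguous v a b k v≼a v≼b a≤k k≤b
    rewrite pos-reverse a | pos-reverse b
    with u , v≼u , u≡ ← contiguous v b a (2 ^ h ∸ k) v≼b v≼a
           (subst (_≤ 2 ^ h ∸ k) (m∸[m∸n]≡n (pos≤2^h π b)) (∸-monoʳ-≤ (2 ^ h) k≤b))
           (subst (2 ^ h ∸ k ≤_) (m∸[m∸n]≡n (pos≤2^h π a)) (∸-monoʳ-≤ (2 ^ h) a≤k))
    = u , v≼u , trans (pos-reverse u) (trans (cong (2 ^ h ∸_) u≡) (m∸[m∸n]≡n k≤2^h))
    where
    k≤2^h : k ≤ 2 ^ h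
    k≤2^h = ≤-trans k≤b (m∸n≤m (2 ^ h) (pos π b))

module _ {h : ℕ} (π : Layout h) where

  offset-distance-below : ∀ {v c y} → Offset π c y → (∀ u → c ≼ u → pos π u < pos π v) →
                          suc y ≤ len π (v , c)
  offset-distance-below {v} {c} offset below =
    subst (suc _ ≤_) (len-reverse π v c)
      (offset-distance (reverse π) (reverse-Offset π offset) λ u c≼u → reverse-< π (below u c≼u))

  inOrder-pair-lower : ∀ {v c₁ c₂ y₁ y₂} → InOrder π v → Child c₁ v → Child c₂ v →
                       Offset π c₁ y₁ → Offset π c₂ y₂ →
                       2 + y₁ + y₂ ≤ len π (v , c₁) + len π (v , c₂)
  inOrder-pair-lower {v} {c₁} {c₂} {y₁} {y₂} (d₁ , d₂ , chd₁ , chd₂ , d₁≢d₂ , below , above) ch₁ ch₂ o₁ o₂ =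
    subst (_≤ len π (v , c₁) + len π (v , c₂)) (2+a+b y₁ y₂)
      (+-mono-≤ (child-distance ch₁ o₁) (child-distance ch₂ o₂))
    where
    child-distance : ∀ {c y} → Child c v → Offset π c y → suc y ≤ len π (v , c)
    child-distance ch o with child-is-one-of chd₁ chd₂ d₁≢d₂ ch
    ... | inj₁ refl = offset-distance-below o below
    ... | inj₂ refl = offset-distance π o above
    2+a+b : ∀ a b → suc a + suc b ≡ 2 + a + b
    2+a+b = solve-∀

  minEnd-far-child : Contiguous π → ∀ {v c c′ y} → MinEnd π v → Child c v → Child c′ v → c ≢ c′ →
                     pos π c < pos π c′ → Offset π c′ y → suc (branchSize v + y) ≤ len π (v , c′)
  minEnd-far-child contiguous {v} {c} {c′} {y} minEnd ch ch′ c≢c′ c<c′ offset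
    with E , unique , refl , inner ← offset-nodes π offset =
    subst (λ n → suc n ≤ _) length≡ (nodes-between π (MinEnd-below-child π minEnd ch′ (≼-refl c′))
      (Unique.++⁺ (subtree-unique c) unique disjoint) between)
    where
    length≡ : length (subtree c ++ E) ≡ branchSize v + length E
    length≡ = trans (length-++ (subtree c)) (cong (_+ length E) (length-subtree-child ch))
    disjoint : ∀ {u} → ¬ (u ∈ subtree c × u ∈ E)
    disjoint (u∈T , u∈E) with ancestors-comparable (∈-subtree⁻ u∈T) (proj₁ (inner u∈E))
    ... | inj₁ c≼c′ = siblings-incomparable ch ch′ c≢c′ c≼c′
    ... | inj₂ c′≼c = siblings-incomparable ch′ ch (c≢c′ ∘ sym) c′≼c
    between : ∀ {u} → u ∈ subtree c ++ E → pos π v < pos π u × pos π u < pos π c′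
    between u∈ with ∈-++⁻ (subtree c) u∈
    ... | inj₁ u∈T = MinEnd-below-child π minEnd ch (∈-subtree⁻ u∈T) ,
                     subtree-below π contiguous (siblings-incomparable ch ch′ c≢c′) c<c′ (∈-subtree⁻ u∈T)
    ... | inj₂ u∈E = MinEnd-below-child π minEnd ch′ (proj₁ (inner u∈E)) , proj₂ (inner u∈E)

  minEnd-pair-lower : Contiguous π → ∀ {v c₁ c₂ y₁ y₂} → MinEnd π v → Child c₁ v → Child c₂ v → c₁ ≢ c₂ →
                      Offset π c₁ y₁ → Offset π c₂ y₂ →
                      2 + branchSize v + y₁ + y₂ ≤ len π (v , c₁) + len π (v , c₂)
  minEnd-pair-lower contiguous {v} {c₁} {c₂} {y₁} {y₂} minEnd ch₁ ch₂ c₁≢c₂ o₁ o₂ =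
    by-order (<-cmp (pos π c₁) (pos π c₂))
    where
    near : ∀ {c y} → Child c v → Offset π c y → suc y ≤ len π (v , c)
    near ch o = offset-distance π o λ u → MinEnd-below-child π minEnd ch
    near-first : ∀ b a c → suc a + suc (b + c) ≡ 2 + b + a + c
    near-first = solve-∀
    far-first : ∀ b a c → suc (b + a) + suc c ≡ 2 + b + a + c
    far-first = solve-∀
    by-order : Tri (pos π c₁ < pos π c₂) (pos π c₁ ≡ pos π c₂) (pos π c₂ < pos π c₁) →
               2 + branchSize v + y₁ + y₂ ≤ len π (v , c₁) + len π (v , c₂)
    by-order (tri< c₁<c₂ _ _) = subst (_≤ len π (v , c₁) + len π (v , c₂)) (near-first (branchSize v) y₁ y₂)
      (+-mono-≤ (near ch₁ o₁) (minEnd-far-child contiguous minEnd ch₁ ch₂ c₁≢c₂ c₁<c₂ o₂))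
    by-order (tri≈ _ c₁≡c₂ _) = ⊥-elim (c₁≢c₂ (pos-injective π c₁≡c₂))
    by-order (tri> _ _ c₂<c₁) = subst (_≤ len π (v , c₁) + len π (v , c₂)) (far-first (branchSize v) y₁ y₂)
      (+-mono-≤ (minEnd-far-child contiguous minEnd ch₂ ch₁ (c₁≢c₂ ∘ sym) c₂<c₁ o₁) (near ch₂ o₂))

module _ {h : ℕ} (π : Layout h) where

  preOrder-pair-lower : Contiguous π → ∀ {v c₁ c₂ y₁ y₂} → PreOrder π v → Child c₁ v → Child c₂ v → c₁ ≢ c₂ →
                        Offset π c₁ y₁ → Offset π c₂ y₂ →
                        2 + branchSize v + y₁ + y₂ ≤ len π (v , c₁) + len π (v , c₂)
  preOrder-pair-lower contiguous (inj₁ minEnd) = minEnd-pair-lower π contiguous minEnd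
  preOrder-pair-lower contiguous {v} {c₁} {c₂} (inj₂ maxEnd) ch₁ ch₂ c₁≢c₂ o₁ o₂ =
    subst₂ (λ l₁ l₂ → _ ≤ l₁ + l₂) (len-reverse π v c₁) (len-reverse π v c₂)
      (minEnd-pair-lower (reverse π) (reverse-Contiguous π contiguous) (reverse-MaxEnd π maxEnd)
        ch₁ ch₂ c₁≢c₂ (reverse-Offset π o₁) (reverse-Offset π o₂))

  gap-in-sibling : Contiguous π → ∀ {w c c′} → MinEnd π w → Child c w → Child c′ w → c ≢ c′ → MinEnd π c′ →
                   ∀ x → pos π w < x → x < pos π c′ → ∃[ u ] (c ≼ u × pos π u ≡ x)
  gap-in-sibling contiguous {w} {c} {c′} minEnd ch ch′ c≢c′ minEnd′ x w<x x<c′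
    with u , w≼u , u≡x ← contiguous w w c′ x (≼-refl w) (parent≼child ch′) (<⇒≤ w<x) (<⇒≤ x<c′)
    with d , chd , d≼u ← descendant-via-child w≼u (λ { refl → <-irrefl u≡x w<x })
    with child-is-one-of ch ch′ c≢c′ chd
  ... | inj₁ refl = u , d≼u , u≡x
  ... | inj₂ refl = ⊥-elim (<⇒≱ x<c′ (subst (_ ≤_) u≡x (minEnd′ u d≼u)))

  minEnd-far-child-upper : Contiguous π → ∀ {w c c′} → MinEnd π w → Child c w → Child c′ w → c ≢ c′ →
                           MinEnd π c′ → len π (w , c′) ≤ suc (branchSize w)
  minEnd-far-child-upper contiguous minEnd ch ch′ c≢c′ minEnd′ =
    subst (λ n → _ ≤ suc n) (length-subtree-child ch)
      (subtree-covers π (MinEnd-below-child π minEnd ch′ (≼-refl _))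
        (gap-in-sibling contiguous minEnd ch ch′ c≢c′ minEnd′))

  minEnd-near-child-upper : Contiguous π → ∀ {w c c′} → MinEnd π w → Child c w → Child c′ w → c ≢ c′ →
                            MinEnd π c → MinEnd π c′ → pos π c < pos π c′ → len π (w , c) ≤ 1
  minEnd-near-child-upper contiguous {w} {c} {c′} minEnd ch ch′ c≢c′ minEndᶜ minEnd′ c<c′ =
    ∣m-n∣≤o (<⇒≤ (MinEnd-below-child π minEnd ch (≼-refl c))) adjacent
    where
    adjacent : pos π c ≤ pos π w + 1
    adjacent with pos π c ℕ.≤? pos π w + 1
    ... | yes c≤w+1 = c≤w+1
    ... | no  c≰w+1 with u , c≼u , u≡ ← gap-in-sibling contiguous minEnd ch ch′ c≢c′ minEnd′
                          (pos π w + 1) (m<m+n _ (s≤s z≤n)) (<-trans (≰⇒> c≰w+1) c<c′)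
      = ⊥-elim (c≰w+1 (subst (pos π c ≤_) u≡ (minEndᶜ u c≼u)))

  minEnd-pair-upper : Contiguous π → ∀ {w c₁ c₂} → MinEnd π w → Child c₁ w → Child c₂ w → c₁ ≢ c₂ →
                      MinEnd π c₁ → MinEnd π c₂ → len π (w , c₁) + len π (w , c₂) ≤ 2 + branchSize w
  minEnd-pair-upper contiguous {w} {c₁} {c₂} minEnd ch₁ ch₂ c₁≢c₂ minEnd₁ minEnd₂
    with <-cmp (pos π c₁) (pos π c₂)
  ... | tri< c₁<c₂ _ _ =
    +-mono-≤ (minEnd-near-child-upper contiguous minEnd ch₁ ch₂ c₁≢c₂ minEnd₁ minEnd₂ c₁<c₂)
             (minEnd-far-child-upper contiguous minEnd ch₁ ch₂ c₁≢c₂ minEnd₂)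
  ... | tri≈ _ c₁≡c₂ _ = ⊥-elim (c₁≢c₂ (pos-injective π c₁≡c₂))
  ... | tri> _ _ c₂<c₁ = subst (len π (w , c₁) + len π (w , c₂) ≤_) (+-comm (suc (branchSize w)) 1)
    (+-mono-≤ (minEnd-far-child-upper contiguous minEnd ch₂ ch₁ (c₁≢c₂ ∘ sym) minEnd₁)
              (minEnd-near-child-upper contiguous minEnd ch₂ ch₁ (c₁≢c₂ ∘ sym) minEnd₂ minEnd₁ c₂<c₁))

  below-child-adjacent : Contiguous π → ∀ {r c c′} → Child c r → Child c′ r → c ≢ c′ →
                         (∀ u → c ≼ u → pos π u < pos π r) → (∀ u → c′ ≼ u → pos π r < pos π u) →
                         MaxEnd π c → len π (r , c) ≤ 1
  below-child-adjacent contiguous {r} {c} {c′} ch ch′ c≢c′ below above maxEnd =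
    subst (_≤ 1) (∣-∣-comm (pos π c) (pos π r)) (∣m-n∣≤o (<⇒≤ (below c (≼-refl c))) adjacent)
    where
    adjacent : pos π r ≤ pos π c + 1
    adjacent with pos π r ℕ.≤? pos π c + 1
    ... | yes r≤c+1 = r≤c+1
    ... | no  r≰c+1
      with u , r≼u , u≡ ← contiguous r c r (pos π c + 1) (parent≼child ch) (≼-refl r)
                              (m≤m+n _ 1) (<⇒≤ (≰⇒> r≰c+1))
      with d , chd , d≼u ← descendant-via-child r≼u (λ { refl → r≰c+1 (≤-reflexive u≡) })
      with child-is-one-of ch ch′ c≢c′ chd
    ...   | inj₁ refl = ⊥-elim (<⇒≱ (m<m+n _ (s≤s z≤n)) (subst (_≤ pos π c) u≡ (maxEnd u d≼u)))
    ...   | inj₂ refl = ⊥-elim (r≰c+1 (subst (pos π r ≤_) u≡ (<⇒≤ (above u d≼u))))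

NearEnd : ∀ {h} → Layout h → Node h → Node h → Set
NearEnd π c p = (pos π p < pos π c → MinEnd π c) × (pos π c < pos π p → MaxEnd π c)

module _ {h : ℕ} (π : Layout h) where

  preOrder-pair-upper : Contiguous π → ∀ {w c₁ c₂} → PreOrder π w → Child c₁ w → Child c₂ w → c₁ ≢ c₂ →
                        NearEnd π c₁ w → NearEnd π c₂ w → len π (w , c₁) + len π (w , c₂) ≤ 2 + branchSize w
  preOrder-pair-upper contiguous (inj₁ minEnd) ch₁ ch₂ c₁≢c₂ near₁ near₂ =
    minEnd-pair-upper π contiguous minEnd ch₁ ch₂ c₁≢c₂
      (proj₁ near₁ (MinEnd-below-child π minEnd ch₁ (≼-refl _)))
      (proj₁ near₂ (MinEnd-below-child π minEnd ch₂ (≼-refl _)))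
  preOrder-pair-upper contiguous {w} {c₁} {c₂} (inj₂ maxEnd) ch₁ ch₂ c₁≢c₂ near₁ near₂ =
    subst₂ (λ l₁ l₂ → l₁ + l₂ ≤ _) (len-reverse π w c₁) (len-reverse π w c₂)
      (minEnd-pair-upper (reverse π) (reverse-Contiguous π contiguous) (reverse-MaxEnd π maxEnd)
        ch₁ ch₂ c₁≢c₂
        (reverse-MaxEnd π (proj₂ near₁ (MaxEnd-above-child π maxEnd ch₁ (≼-refl _))))
        (reverse-MaxEnd π (proj₂ near₂ (MaxEnd-above-child π maxEnd ch₂ (≼-refl _)))))

  inOrder-child-upper : Contiguous π → ∀ {r c} → InOrder π r → Child c r → NearEnd π c r → len π (r , c) ≤ 1
  inOrder-child-upper contiguous {r} (d₁ , d₂ , ch₁ , ch₂ , d₁≢d₂ , below , above) ch near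
    with child-is-one-of ch₁ ch₂ d₁≢d₂ ch
  ... | inj₁ refl = below-child-adjacent π contiguous ch₁ ch₂ d₁≢d₂ below above
                      (proj₂ near (below d₁ (≼-refl d₁)))
  ... | inj₂ refl = subst (_≤ 1) (len-reverse π r d₂)
                      (below-child-adjacent (reverse π) (reverse-Contiguous π contiguous) ch₂ ch₁ (d₁≢d₂ ∘ sym)
                        (λ u d₂≼u → reverse-< π (above u d₂≼u)) (λ u d₁≼u → reverse-< π (below u d₁≼u))
                        (reverse-MinEnd π (proj₁ near (above d₂ (≼-refl d₂)))))

-- 2^k times the weighted sum of F over the edges of T_(k+1).
cost : ∀ k → (Node (suc k) × Node (suc k) → ℕ) → ℕ
cost zero    F = 0
cost (suc j) F = 2 ^ j * (F (root , left root) + F (root , right root))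
               + (cost j (F ∘ ×.map left left) + cost j (F ∘ ×.map right right))

-- Charging 2 + b(v) to every internal node of T_(k+1) gives preOrderCost k; charging only 2 to the
-- root of T_(j+2) gives minWLACost j.
preOrderCost : ℕ → ℕ
preOrderCost zero    = 0
preOrderCost (suc j) = 2 ^ j * (2 + (2 ^ suc j ∸ 1)) + (preOrderCost j + preOrderCost j)

minWLACost : ℕ → ℕ
minWLACost j = 2 ^ j * 2 + (preOrderCost j + preOrderCost j)

module _ {h : ℕ} where

  PairLowerBound : (Node h × Node h → ℕ) → (Node h → ℕ) → (Node h → ℕ) → Set
  PairLowerBound F X Y = ∀ {v c₁ c₂} → Child c₁ v → Child c₂ v → c₁ ≢ c₂ →
                         2 + X v + Y c₁ + Y c₂ ≤ F (v , c₁) + F (v , c₂)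

  ExcessCovers : (Node h → ℕ) → (Node h → ℕ) → Set
  ExcessCovers X Y = ∀ {v c} → Child c v → branchSize v ≤ 2 * Y v + X v

  PairUpperBound : (Node h × Node h → ℕ) → Set
  PairUpperBound F = ∀ {v c₁ c₂} → Child c₁ v → Child c₂ v → c₁ ≢ c₂ →
                     F (v , c₁) + F (v , c₂) ≤ 2 + branchSize v

module Restriction {h : ℕ} (emb : Node h → Node (suc h))
                (emb-child : ∀ {c v} → Child c v → Child (emb c) (emb v))
                (emb-injective : ∀ {u v} → emb u ≡ emb v → u ≡ v)
                (branchSize-emb : ∀ v → branchSize (emb v) ≡ branchSize v) where

  restrict-lower : ∀ F X Y → PairLowerBound F X Y → PairLowerBound (F ∘ ×.map emb emb) (X ∘ emb) (Y ∘ emb)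
  restrict-lower F X Y lower ch₁ ch₂ c₁≢c₂ = lower (emb-child ch₁) (emb-child ch₂) (c₁≢c₂ ∘ emb-injective)

  restrict-covers : ∀ X Y → ExcessCovers X Y → ExcessCovers (X ∘ emb) (Y ∘ emb)
  restrict-covers X Y covers {v} ch =
    subst (_≤ 2 * Y (emb v) + X (emb v)) (branchSize-emb v) (covers (emb-child ch))

  restrict-upper : ∀ F → PairUpperBound F → PairUpperBound (F ∘ ×.map emb emb)
  restrict-upper F upper {v} {c₁} {c₂} ch₁ ch₂ c₁≢c₂ =
    subst (λ b → F (emb v , emb c₁) + F (emb v , emb c₂) ≤ 2 + b) (branchSize-emb v)
      (upper (emb-child ch₁) (emb-child ch₂) (c₁≢c₂ ∘ emb-injective))

module LeftSubtree {h} = Restriction {h} left cl left-injective (λ _ → refl)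
module RightSubtree {h} = Restriction {h} right cr right-injective (λ _ → refl)

-- The term 2^k * Y root is the part of the root's excess charged to the edge above the root.
cost-lower : ∀ k F X Y → PairLowerBound F X Y → ExcessCovers X Y →
             preOrderCost k ≤ cost k F + 2 ^ k * Y root
subtrees-cost-lower : ∀ j F X Y → PairLowerBound F X Y → ExcessCovers X Y →
  preOrderCost j + preOrderCost j ≤
  (cost j (F ∘ ×.map left left) + 2 ^ j * Y (left root)) +
  (cost j (F ∘ ×.map right right) + 2 ^ j * Y (right root))

cost-lower zero    _ _ _ _ _ = z≤n
cost-lower (suc j) F X Y lower covers = begin
  a * (2 + (2 ^ suc j ∸ 1)) + (preOrderCost j + preOrderCost j)
    ≤⟨ +-mono-≤ (*-monoʳ-≤ a root-excess) (subtrees-cost-lower j F X Y lower covers) ⟩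
  a * (2 + X root + 2 * Y root) + ((Cₗ + a * Y (left root)) + (Cᵣ + a * Y (right root)))
    ≡⟨ regroup a (X root) (Y root) (Y (left root)) (Y (right root)) Cₗ Cᵣ ⟩
  a * (2 + X root + Y (left root) + Y (right root)) + (Cₗ + Cᵣ) + 2 * a * Y root
    ≤⟨ +-monoˡ-≤ _ (+-monoˡ-≤ _ (*-monoʳ-≤ a (lower lc rc λ ()))) ⟩
  a * (F (root , left root) + F (root , right root)) + (Cₗ + Cᵣ) + 2 * a * Y root
    ∎
  where
  open ≤-Reasoning
  a = 2 ^ j
  Cₗ = cost j (F ∘ ×.map left left)
  Cᵣ = cost j (F ∘ ×.map right right)
  root-excess : 2 + (2 ^ suc j ∸ 1) ≤ 2 + X root + 2 * Y root
  root-excess = subst (2 + (2 ^ suc j ∸ 1) ≤_) (reorder 2 (X root) (2 * Y root)) (+-monoʳ-≤ 2 (covers lc))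
    where
    reorder : ∀ m n o → m + (o + n) ≡ m + n + o
    reorder = solve-∀
  regroup : ∀ a x y yₗ yᵣ cₗ cᵣ → a * (2 + x + 2 * y) + ((cₗ + a * yₗ) + (cᵣ + a * yᵣ))
                                  ≡ a * (2 + x + yₗ + yᵣ) + (cₗ + cᵣ) + 2 * a * y
  regroup = solve-∀

subtrees-cost-lower j F X Y lower covers =
  +-mono-≤ (cost-lower j (F ∘ ×.map left left) (X ∘ left) (Y ∘ left)
             (LeftSubtree.restrict-lower F X Y lower) (LeftSubtree.restrict-covers X Y covers))
           (cost-lower j (F ∘ ×.map right right) (X ∘ right) (Y ∘ right)
             (RightSubtree.restrict-lower F X Y lower) (RightSubtree.restrict-covers X Y covers))

cost-lower-root : ∀ j F X Y → PairLowerBound F X Y → ExcessCovers X Y → minWLACost j ≤ cost (suc j) F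
cost-lower-root j F X Y lower covers = begin
  a * 2 + (preOrderCost j + preOrderCost j)
    ≤⟨ +-monoʳ-≤ (a * 2) (subtrees-cost-lower j F X Y lower covers) ⟩
  a * 2 + ((Cₗ + a * Y (left root)) + (Cᵣ + a * Y (right root)))
    ≡⟨ regroup a (Y (left root)) (Y (right root)) Cₗ Cᵣ ⟩
  a * (2 + Y (left root) + Y (right root)) + (Cₗ + Cᵣ)
    ≤⟨ +-monoˡ-≤ _ (*-monoʳ-≤ a (≤-trans drop-root-excess (lower lc rc λ ()))) ⟩
  cost (suc j) F
    ∎
  where
  open ≤-Reasoning
  a = 2 ^ j
  Cₗ = cost j (F ∘ ×.map left left)
  Cᵣ = cost j (F ∘ ×.map right right)
  drop-root-excess : 2 + Y (left root) + Y (right root) ≤ 2 + X root + Y (left root) + Y (right root)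
  drop-root-excess = +-monoˡ-≤ _ (+-monoˡ-≤ _ (m≤m+n 2 (X root)))
  regroup : ∀ a yₗ yᵣ cₗ cᵣ → a * 2 + ((cₗ + a * yₗ) + (cᵣ + a * yᵣ)) ≡ a * (2 + yₗ + yᵣ) + (cₗ + cᵣ)
  regroup = solve-∀

cost-upper : ∀ k F → PairUpperBound F → cost k F ≤ preOrderCost k
cost-upper zero    _ _     = z≤n
cost-upper (suc j) F upper =
  +-mono-≤ (*-monoʳ-≤ (2 ^ j) (upper lc rc λ ()))
           (+-mono-≤ (cost-upper j _ (LeftSubtree.restrict-upper F upper))
                     (cost-upper j _ (RightSubtree.restrict-upper F upper)))

cost-upper-root : ∀ j F → F (root , left root) + F (root , right root) ≤ 2 →
                  PairUpperBound (F ∘ ×.map left left) → PairUpperBound (F ∘ ×.map right right) →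
                  cost (suc j) F ≤ minWLACost j
cost-upper-root j F root-edges upperₗ upperᵣ =
  +-mono-≤ (*-monoʳ-≤ (2 ^ j) root-edges) (+-mono-≤ (cost-upper j _ upperₗ) (cost-upper j _ upperᵣ))

coprimeTo1 : ∀ n → Coprime.Coprime n 1
coprimeTo1 n = Coprime.sym (Coprime.1-coprimeTo n)

ℕtoℚ≡mkℚ : ∀ n → ℕtoℚ n ≡ mkℚ (+ n) 0 (coprimeTo1 n)
ℕtoℚ≡mkℚ n = ℚ.normalize-coprime (coprimeTo1 n)

ℕtoℚ-+ : ∀ m n → ℕtoℚ (m + n) ≡ ℕtoℚ m ℚ.+ ℕtoℚ n
ℕtoℚ-+ m n rewrite ℕtoℚ≡mkℚ (m + n) | ℕtoℚ≡mkℚ m | ℕtoℚ≡mkℚ n =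
  ℚ.toℚᵘ-injective (ℚᵘ.≃-trans (ℚᵘ.*≡* cross)
    (ℚᵘ.≃-sym (ℚ.toℚᵘ-homo-+ (mkℚ (+ m) 0 (coprimeTo1 m)) (mkℚ (+ n) 0 (coprimeTo1 n)))))
  where
  cross : + (m + n) ℤ.* + 1 ≡ (+ m ℤ.* + 1 ℤ.+ + n ℤ.* + 1) ℤ.* + 1
  cross rewrite ℤ.*-identityʳ (+ (m + n)) | ℤ.*-identityʳ (+ m) | ℤ.*-identityʳ (+ n)
              | ℤ.*-identityʳ (+ m ℤ.+ + n) = ℤ.pos-+ m n

ℕtoℚ-* : ∀ m n → ℕtoℚ (m * n) ≡ ℕtoℚ m ℚ.* ℕtoℚ n
ℕtoℚ-* m n rewrite ℕtoℚ≡mkℚ (m * n) | ℕtoℚ≡mkℚ m | ℕtoℚ≡mkℚ n =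
  ℚ.toℚᵘ-injective (ℚᵘ.≃-trans (ℚᵘ.*≡* cross)
    (ℚᵘ.≃-sym (ℚ.toℚᵘ-homo-* (mkℚ (+ m) 0 (coprimeTo1 m)) (mkℚ (+ n) 0 (coprimeTo1 n)))))
  where
  cross : + (m * n) ℤ.* + 1 ≡ (+ m ℤ.* + n) ℤ.* + 1
  cross = cong (ℤ._* + 1) (ℤ.pos-* m n)

ℕtoℚ-mono-≤ : ∀ {m n} → m ≤ n → ℕtoℚ m ≤ℚ ℕtoℚ n
ℕtoℚ-mono-≤ {m} {n} m≤n rewrite ℕtoℚ≡mkℚ m | ℕtoℚ≡mkℚ n =
  ℚ.*≤* (subst₂ ℤ._≤_ (sym (ℤ.*-identityʳ (+ m))) (sym (ℤ.*-identityʳ (+ n))) (+≤+ m≤n))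

halfPow-nonNeg : ∀ d → NonNegative (halfPow d)
halfPow-nonNeg zero    = _
halfPow-nonNeg (suc d) = ℚ.nonNeg*nonNeg⇒nonNeg ½ (halfPow d) {{halfPow-nonNeg d}}

2^n*halfPow : ∀ n → ℕtoℚ (2 ^ n) ℚ.* halfPow n ≡ 1ℚ
2^n*halfPow zero    = refl
2^n*halfPow (suc n) = begin
  ℕtoℚ (2 * 2 ^ n) ℚ.* (½ ℚ.* halfPow n)           ≡⟨ cong (ℚ._* (½ ℚ.* halfPow n)) (ℕtoℚ-* 2 (2 ^ n)) ⟩
  ℕtoℚ 2 ℚ.* ℕtoℚ (2 ^ n) ℚ.* (½ ℚ.* halfPow n)    ≡⟨ regroup (ℕtoℚ 2) (ℕtoℚ (2 ^ n)) ½ (halfPow n) ⟩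
  (ℕtoℚ 2 ℚ.* ½) ℚ.* (ℕtoℚ (2 ^ n) ℚ.* halfPow n)  ≡⟨ cong ((ℕtoℚ 2 ℚ.* ½) ℚ.*_) (2^n*halfPow n) ⟩
  (ℕtoℚ 2 ℚ.* ½) ℚ.* 1ℚ                            ≡⟨⟩
  1ℚ                                               ∎
  where
  open ≡-Reasoning
  open +-*-Solver
  regroup : ∀ a b c d → a ℚ.* b ℚ.* (c ℚ.* d) ≡ (a ℚ.* c) ℚ.* (b ℚ.* d)
  regroup = solve 4 (λ a b c d → a :* b :* (c :* d) := (a :* c) :* (b :* d)) refl

Σ : ∀ {A : Set} → List A → (A → ℚ) → ℚ
Σ xs g = foldr (λ x s → g x ℚ.+ s) 0ℚ xs

Σ-++ : ∀ {A : Set} (xs ys : List A) g → Σ (xs ++ ys) g ≡ Σ xs g ℚ.+ Σ ys g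
Σ-++ []       ys g = sym (ℚ.+-identityˡ (Σ ys g))
Σ-++ (x ∷ xs) ys g = trans (cong (g x ℚ.+_) (Σ-++ xs ys g)) (sym (ℚ.+-assoc (g x) (Σ xs g) (Σ ys g)))

Σ-cong : ∀ {A : Set} (xs : List A) {g g′ : A → ℚ} → (∀ x → g x ≡ g′ x) → Σ xs g ≡ Σ xs g′
Σ-cong []       _  = refl
Σ-cong (x ∷ xs) eq = cong₂ ℚ._+_ (eq x) (Σ-cong xs eq)

Σ-*ˡ : ∀ {A : Set} (xs : List A) c g → Σ xs (λ x → c ℚ.* g x) ≡ c ℚ.* Σ xs g
Σ-*ˡ []       c g = sym (ℚ.*-zeroʳ c)
Σ-*ˡ (x ∷ xs) c g = trans (cong (c ℚ.* g x ℚ.+_) (Σ-*ˡ xs c g)) (sym (ℚ.*-distribˡ-+ c (g x) (Σ xs g)))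

weightedSum : ∀ h → (Node h × Node h → ℕ) → ℚ
weightedSum h F = Σ (edges h) (λ e → weight e ℚ.* ℕtoℚ (F e))

weightedSum-subtree : ∀ {h} (emb : Node h → Node (suc h)) → (∀ v → depth (emb v) ≡ suc (depth v)) →
  ∀ F → Σ (map (×.map emb emb) (edges h)) (λ e → weight e ℚ.* ℕtoℚ (F e)) ≡ ½ ℚ.* weightedSum h (F ∘ ×.map emb emb)
weightedSum-subtree {h} emb depth-emb F = begin
  Σ (map (×.map emb emb) (edges h)) (λ e → weight e ℚ.* ℕtoℚ (F e))
    ≡⟨ foldr-map _ (×.map emb emb) 0ℚ (edges h) ⟩
  Σ (edges h) (λ e → weight (×.map emb emb e) ℚ.* ℕtoℚ (F (×.map emb emb e)))
    ≡⟨ Σ-cong (edges h) halve ⟩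
  Σ (edges h) (λ e → ½ ℚ.* (weight e ℚ.* ℕtoℚ (F (×.map emb emb e))))
    ≡⟨ Σ-*ˡ (edges h) ½ (λ e → weight e ℚ.* ℕtoℚ (F (×.map emb emb e))) ⟩
  ½ ℚ.* weightedSum h (F ∘ ×.map emb emb) ∎
  where
  open ≡-Reasoning
  halve : ∀ e → weight (×.map emb emb e) ℚ.* ℕtoℚ (F (×.map emb emb e))
                ≡ ½ ℚ.* (weight e ℚ.* ℕtoℚ (F (×.map emb emb e)))
  halve (p , c) rewrite depth-emb c = ℚ.*-assoc ½ (halfPow (depth c)) _

weightedSum≡cost : ∀ k F → weightedSum (suc k) F ≡ ℕtoℚ (cost k F) ℚ.* halfPow k
weightedSum≡cost zero    F = refl
weightedSum≡cost (suc j) F = begin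
  weightedSum (suc (suc j)) F
    ≡⟨ Σ-++ (rootEdges (suc j)) (Eₗ ++ Eᵣ) g ⟩
  Σ (rootEdges (suc j)) g ℚ.+ Σ (Eₗ ++ Eᵣ) g
    ≡⟨ cong (Σ (rootEdges (suc j)) g ℚ.+_) (Σ-++ Eₗ Eᵣ g) ⟩
  Σ (rootEdges (suc j)) g ℚ.+ (Σ Eₗ g ℚ.+ Σ Eᵣ g)
    ≡⟨ cong₂ (λ l r → Σ (rootEdges (suc j)) g ℚ.+ (l ℚ.+ r))
         (weightedSum-subtree left (λ _ → refl) F) (weightedSum-subtree right (λ _ → refl) F) ⟩
  Σ (rootEdges (suc j)) g ℚ.+ (½ ℚ.* weightedSum (suc j) Fₗ ℚ.+ ½ ℚ.* weightedSum (suc j) Fᵣ)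
    ≡⟨ cong₂ (λ l r → Σ (rootEdges (suc j)) g ℚ.+ (½ ℚ.* l ℚ.+ ½ ℚ.* r))
             (weightedSum≡cost j Fₗ) (weightedSum≡cost j Fᵣ) ⟩
  (½ ℚ.* 1ℚ ℚ.* f₁ ℚ.+ (½ ℚ.* 1ℚ ℚ.* f₂ ℚ.+ 0ℚ)) ℚ.+ (½ ℚ.* (cₗ ℚ.* hp) ℚ.+ ½ ℚ.* (cᵣ ℚ.* hp))
    ≡⟨ regroup₁ f₁ f₂ cₗ cᵣ hp ⟩
  ½ ℚ.* (f₁ ℚ.+ f₂) ℚ.* 1ℚ ℚ.+ ½ ℚ.* hp ℚ.* (cₗ ℚ.+ cᵣ)
    ≡⟨ cong (λ t → ½ ℚ.* (f₁ ℚ.+ f₂) ℚ.* t ℚ.+ ½ ℚ.* hp ℚ.* (cₗ ℚ.+ cᵣ)) (sym (2^n*halfPow j)) ⟩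
  ½ ℚ.* (f₁ ℚ.+ f₂) ℚ.* (a ℚ.* hp) ℚ.+ ½ ℚ.* hp ℚ.* (cₗ ℚ.+ cᵣ)
    ≡⟨ regroup₂ a f₁ f₂ cₗ cᵣ hp ⟩
  (a ℚ.* (f₁ ℚ.+ f₂) ℚ.+ (cₗ ℚ.+ cᵣ)) ℚ.* (½ ℚ.* hp)
    ≡⟨ cong (ℚ._* (½ ℚ.* hp)) (sym cast) ⟩
  ℕtoℚ (cost (suc j) F) ℚ.* halfPow (suc j) ∎
  where
  open ≡-Reasoning
  open +-*-Solver
  g = λ e → weight e ℚ.* ℕtoℚ (F e)
  Eₗ = map (×.map left left) (edges (suc j))
  Eᵣ = map (×.map right right) (edges (suc j))
  Fₗ = F ∘ ×.map left left
  Fᵣ = F ∘ ×.map right right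
  F₁ = F (root , left root)
  F₂ = F (root , right root)
  f₁ = ℕtoℚ F₁
  f₂ = ℕtoℚ F₂
  cₗ = ℕtoℚ (cost j Fₗ)
  cᵣ = ℕtoℚ (cost j Fᵣ)
  a = ℕtoℚ (2 ^ j)
  hp = halfPow j
  cast : ℕtoℚ (cost (suc j) F) ≡ a ℚ.* (f₁ ℚ.+ f₂) ℚ.+ (cₗ ℚ.+ cᵣ)
  cast = trans (ℕtoℚ-+ (2 ^ j * (F₁ + F₂)) (cost j Fₗ + cost j Fᵣ))
           (cong₂ ℚ._+_ (trans (ℕtoℚ-* (2 ^ j) (F₁ + F₂)) (cong (a ℚ.*_) (ℕtoℚ-+ F₁ F₂)))
                        (ℕtoℚ-+ (cost j Fₗ) (cost j Fᵣ)))
  regroup₁ : ∀ x₁ x₂ y₁ y₂ t →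
    (½ ℚ.* 1ℚ ℚ.* x₁ ℚ.+ (½ ℚ.* 1ℚ ℚ.* x₂ ℚ.+ 0ℚ)) ℚ.+ (½ ℚ.* (y₁ ℚ.* t) ℚ.+ ½ ℚ.* (y₂ ℚ.* t))
    ≡ ½ ℚ.* (x₁ ℚ.+ x₂) ℚ.* 1ℚ ℚ.+ ½ ℚ.* t ℚ.* (y₁ ℚ.+ y₂)
  regroup₁ = solve 5 (λ x₁ x₂ y₁ y₂ t →
    (con ½ :* con 1ℚ :* x₁ :+ (con ½ :* con 1ℚ :* x₂ :+ con 0ℚ)) :+ (con ½ :* (y₁ :* t) :+ con ½ :* (y₂ :* t))
    := con ½ :* (x₁ :+ x₂) :* con 1ℚ :+ con ½ :* t :* (y₁ :+ y₂)) refl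
  regroup₂ : ∀ a x₁ x₂ y₁ y₂ t →
    ½ ℚ.* (x₁ ℚ.+ x₂) ℚ.* (a ℚ.* t) ℚ.+ ½ ℚ.* t ℚ.* (y₁ ℚ.+ y₂) ≡ (a ℚ.* (x₁ ℚ.+ x₂) ℚ.+ (y₁ ℚ.+ y₂)) ℚ.* (½ ℚ.* t)
  regroup₂ = solve 6 (λ a x₁ x₂ y₁ y₂ t →
    con ½ :* (x₁ :+ x₂) :* (a :* t) :+ con ½ :* t :* (y₁ :+ y₂)
    := (a :* (x₁ :+ x₂) :+ (y₁ :+ y₂)) :* (con ½ :* t)) refl

weightedSum-mono : ∀ k {F G} → cost k F ≤ cost k G → weightedSum (suc k) F ≤ℚ weightedSum (suc k) G
weightedSum-mono k {F} {G} F≤G rewrite weightedSum≡cost k F | weightedSum≡cost k G =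
  ℚ.*-monoʳ-≤-nonNeg (halfPow k) {{halfPow-nonNeg k}} (ℕtoℚ-mono-≤ F≤G)

Σ-weight-nonNeg : ∀ {h} (es : List (Node h × Node h)) → 0ℚ ≤ℚ Σ es weight
Σ-weight-nonNeg []             = ℚ.≤-refl
Σ-weight-nonNeg ((_ , c) ∷ es) =
  ℚ.+-mono-≤ (ℚ.nonNegative⁻¹ (halfPow (depth c)) {{halfPow-nonNeg (depth c)}}) (Σ-weight-nonNeg es)

div-monoˡ : ∀ {p q r} → p ≤ℚ q → 0ℚ ≤ℚ r → p div r ≤ℚ q div r
div-monoˡ {r = r} p≤q 0≤r with r ℚ.≟ 0ℚ
... | yes _   = ℚ.≤-refl
... | no  r≢0 = ℚ.*-monoʳ-≤-nonNeg 1/r {{ℚ.pos⇒nonNeg 1/r {{ℚ.1/pos⇒pos r {{r>0}}}}}} p≤q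
  where
  1/r = ℚ.1/_ r {{ℚ.≢-nonZero r≢0}}
  r>0 : ℚ.Positive r
  r>0 = ℚ.nonNeg∧nonZero⇒pos r {{ℚ.nonNegative 0≤r}} {{ℚ.≢-nonZero r≢0}}

meanLength-mono : ∀ {k} (π σ : Layout (suc k)) → cost k (len π) ≤ cost k (len σ) → meanLength π ≤ℚ meanLength σ
meanLength-mono {k} π σ cost≤ = div-monoˡ (weightedSum-mono k cost≤) (Σ-weight-nonNeg (edges (suc k)))

data Kind {h : ℕ} (σ : Layout h) (v : Node h) : Set where
  inOrder  : InOrder σ v → Kind σ v
  preOrder : PreOrder σ v → Kind σ v
  leaf     : Leaf v → Kind σ v

kind : ∀ {h} (σ : Layout h) → (∀ v → HasChildren v → InOrder σ v ⊎ PreOrder σ v) → ∀ v → Kind σ v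
kind σ types v with hasChildren? v
... | inj₂ isLeaf = leaf isLeaf
... | inj₁ hasCh with types v hasCh
...   | inj₁ isInOrder  = inOrder isInOrder
...   | inj₂ isPreOrder = preOrder isPreOrder

module _ {h : ℕ} {σ : Layout h} where

  childEdgeExcess : ∀ {v} → Kind σ v → ℕ
  childEdgeExcess {v} (preOrder _) = branchSize v
  childEdgeExcess     _            = 0

  parentEdgeExcess : ∀ {v} → Kind σ v → ℕ
  parentEdgeExcess {v} (inOrder _) = branchSize v
  parentEdgeExcess     _           = 0

  parentEdgeExcess-Offset : ∀ {c} (k : Kind σ c) → Offset σ c (parentEdgeExcess k)
  parentEdgeExcess-Offset (inOrder isInOrder) = inj₂ (isInOrder , refl)
  parentEdgeExcess-Offset (preOrder _)        = inj₁ refl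
  parentEdgeExcess-Offset (leaf _)            = inj₁ refl

  excess-covers : ∀ {v c} (k : Kind σ v) → Child c v → branchSize v ≤ 2 * parentEdgeExcess k + childEdgeExcess k
  excess-covers {v} (inOrder _) _  = ≤-trans (m≤m+n (branchSize v) _) (m≤m+n _ 0)
  excess-covers     (preOrder _) _ = ≤-refl
  excess-covers     (leaf isLeaf) ch = ⊥-elim (leaf-childless isLeaf ch)

  kind-pair-lower : Contiguous σ → ∀ {v c₁ c₂ y₁ y₂} (k : Kind σ v) → Child c₁ v → Child c₂ v → c₁ ≢ c₂ →
                    Offset σ c₁ y₁ → Offset σ c₂ y₂ →
                    2 + childEdgeExcess k + y₁ + y₂ ≤ len σ (v , c₁) + len σ (v , c₂)
  kind-pair-lower contiguous (inOrder isInOrder)   ch₁ ch₂ _ = inOrder-pair-lower σ isInOrder ch₁ ch₂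
  kind-pair-lower contiguous (preOrder isPreOrder) = preOrder-pair-lower σ contiguous isPreOrder
  kind-pair-lower contiguous (leaf isLeaf) ch₁ = ⊥-elim (leaf-childless isLeaf ch₁)

recursive-cost : ∀ {j} (σ : Layout (suc (suc j))) → RecursiveLayout σ → minWLACost j ≤ cost (suc j) (len σ)
recursive-cost σ (contiguous , types , _) =
  cost-lower-root _ (len σ) (childEdgeExcess ∘ kinds) (parentEdgeExcess ∘ kinds)
    (λ {v} {c₁} {c₂} ch₁ ch₂ c₁≢c₂ → kind-pair-lower contiguous (kinds v) ch₁ ch₂ c₁≢c₂
       (parentEdgeExcess-Offset (kinds c₁)) (parentEdgeExcess-Offset (kinds c₂)))
    (λ {v} ch → excess-covers (kinds v) ch)
  where
  kinds = kind σ types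

module _ {h : ℕ} (π : Layout h) (minWLA : MinWLAType π) where

  private
    contiguous : Contiguous π
    contiguous = proj₁ (proj₁ minWLA)

  near-end : ∀ {c p} → Child c p → NearEnd π c p
  near-end {c} {p} ch with hasChildren? c
  ... | inj₁ hasCh  = proj₁ (proj₂ (proj₂ (proj₁ minWLA))) c p ch hasCh
                        (proj₂ (proj₂ minWLA) c hasCh λ isRoot → isRoot (p , ch))
  ... | inj₂ isLeaf = (λ _ u c≼u → ≤-reflexive (cong (pos π) (sym (isLeaf u c≼u))))
                    , (λ _ u c≼u → ≤-reflexive (cong (pos π) (isLeaf u c≼u)))

  nonRoot-pair-upper : ∀ {w c₁ c₂} → ¬ IsRoot w → Child c₁ w → Child c₂ w → c₁ ≢ c₂ →
                       len π (w , c₁) + len π (w , c₂) ≤ 2 + branchSize w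
  nonRoot-pair-upper {w} {c₁} notRoot ch₁ ch₂ c₁≢c₂ =
    preOrder-pair-upper π contiguous (proj₂ (proj₂ minWLA) w (c₁ , ch₁) notRoot) ch₁ ch₂ c₁≢c₂
      (near-end ch₁) (near-end ch₂)

minWLA-cost : ∀ {j} (π : Layout (suc (suc j))) → MinWLAType π → cost (suc j) (len π) ≤ minWLACost j
minWLA-cost π minWLA =
  cost-upper-root _ (len π) (+-mono-≤ (root-edge lc) (root-edge rc))
    (λ ch₁ ch₂ c₁≢c₂ → nonRoot-pair-upper π minWLA (left-not-root _) (cl ch₁) (cl ch₂) (c₁≢c₂ ∘ left-injective))
    (λ ch₁ ch₂ c₁≢c₂ → nonRoot-pair-upper π minWLA (right-not-root _) (cr ch₁) (cr ch₂) (c₁≢c₂ ∘ right-injective))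
  where
  root-edge : ∀ {c} → Child c root → len π (root , c) ≤ 1
  root-edge ch = inOrder-child-upper π (proj₁ (proj₁ minWLA))
                   (proj₁ (proj₂ minWLA) root (_ , ch) root-isRoot) ch (near-end π minWLA ch)

theorem1 : ∀ (h : ℕ) → 2 ≤ h → (π : Layout h) → MinWLAType π →
           (σ : Layout h) → RecursiveLayout σ → meanLength π ≤ℚ meanLength σ
theorem1 (suc zero)    (s≤s ()) _ _ _ _
theorem1 (suc (suc j)) _        π minWLA σ recursive =
  meanLength-mono π σ (≤-trans (minWLA-cost π minWLA) (recursive-cost σ recursive))
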